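{- For every $m\ge1$, the poset $(\mathcal{P}_m,\le_m)$ is a lattice.
   Context: $\mathcal{P}_m$ is the set of nonincreasing words $C=C_1C_2\cdots C_m$ of length $m$ with letters in $\mathbb{Z}$ ($C_1\ge C_2\ge\cdots\ge C_m$). For $C,D\in\mathcal{P}_m$, $D\le_m C$ if and only if $D_i\le C_i$ for all $i$, and $D_i>D_{i+1}$ whenever $C_i>C_{i+1}$. -}

module Defs where

open import Data.Nat using (ℕ; suc)
open import Data.Fin using (Fin; toℕ)
open import Data.Integer using (ℤ; _≤_; _<_)
open import Data.Vec using (Vec; lookup)
open import Data.Product using (Σ; proj₁)
open import Relation.Binary.PropositionalEquality using (_≡_)

Adjacent : ∀ {m} → Fin m → Fin m → Set
Adjacent i j = toℕ j ≡ suc (toℕ i)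

Nonincreasing : ∀ {m} → Vec ℤ m → Set
Nonincreasing {m} C = (i j : Fin m) → Adjacent i j → lookup C j ≤ lookup C i

𝒫 : ℕ → Set
𝒫 m = Σ (Vec ℤ m) Nonincreasing

_≈ₘ_ : ∀ {m} → 𝒫 m → 𝒫 m → Set
D ≈ₘ C = proj₁ D ≡ proj₁ C

_≤ₘ_ : ∀ {m} → 𝒫 m → 𝒫 m → Set
_≤ₘ_ {m} D C =
  ((i : Fin m) → lookup (proj₁ D) i ≤ lookup (proj₁ C) i)
  Data.Product.×
  ((i j : Fin m) → Adjacent i j →
     lookup (proj₁ C) j < lookup (proj₁ C) i →
     lookup (proj₁ D) j < lookup (proj₁ D) i)

-- The conditions defining P_m and ≤_m only compare neighbouring positions, so both become
-- "chains" that can be handled by induction along the word.  The join of C and D keeps a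
-- plateau wherever C or D has one and otherwise takes max(C_i, D_i): a descent of an upper
-- bound must be a descent of both C and D, and the pointwise maximum is forced at every
-- descent.  Dually the meet descends wherever C or D does, taking min(C_i, D_i, previous − 1)
-- there, and otherwise repeats the previous letter.
module Submission where

open import Defs
open import Level using (Level)
open import Data.Nat as ℕ using (ℕ; zero; suc)
open import Data.Product using (Σ; _,_; _×_; proj₁; proj₂)
open import Data.Integer using (ℤ; _≤_; _<_; _≥_; _⊔_; _⊓_; pred)
open import Data.Integer.Properties
open import Data.Fin as Fin using (Fin)
open import Data.Vec using (Vec; []; _∷_; lookup; zip)
open import Data.Vec.Properties using (lookup-zip)
open import Data.Vec.Relation.Binary.Pointwise.Extensional using (ext; Pointwise-≡⇒≡)
open import Data.Unit.Polymorphic using (⊤; tt)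
open import Data.Empty using (⊥-elim)
open import Relation.Nullary using (yes; no)
open import Relation.Binary.PropositionalEquality using (refl; sym; trans; cong)
open import Relation.Binary.Structures using (IsPartialOrder)
open import Relation.Binary.Lattice.Definitions using (Supremum; Infimum)
open import Relation.Binary.Lattice.Structures using (IsLattice)
open import Algebra.Core using (Op₂)
import Data.Nat.Properties as ℕₚ

private
  variable
    a p : Level
    A : Set a
    n : ℕ
    c d e f f′ x y : ℤ
    xs ys fs : Vec ℤ n

Chain : (A → A → Set p) → A → Vec A n → Set p
Chain R a []       = ⊤
Chain R a (x ∷ xs) = R a x × Chain R x xs

module _ {R : A → A → Set p} where

  chain⇒adjacent : ∀ {a} {xs : Vec A n} → Chain R a xs →
    (i j : Fin (suc n)) → Adjacent i j → R (lookup (a ∷ xs) i) (lookup (a ∷ xs) j)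
  chain⇒adjacent {xs = x ∷ xs} (r , _) Fin.zero (Fin.suc Fin.zero) _    = r
  chain⇒adjacent {xs = x ∷ xs} (_ , c) (Fin.suc i) (Fin.suc j)     i~j  =
    chain⇒adjacent c i j (ℕₚ.suc-injective i~j)
  chain⇒adjacent {xs = []}     _       Fin.zero Fin.zero           ()
  chain⇒adjacent {xs = x ∷ xs} _       Fin.zero Fin.zero           ()
  chain⇒adjacent {xs = x ∷ xs} _       Fin.zero (Fin.suc (Fin.suc _)) ()
  chain⇒adjacent {xs = x ∷ xs} _       (Fin.suc _) Fin.zero        ()

  adjacent⇒chain : ∀ {a} (xs : Vec A n) →
    ((i j : Fin (suc n)) → Adjacent i j → R (lookup (a ∷ xs) i) (lookup (a ∷ xs) j)) →
    Chain R a xs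
  adjacent⇒chain []       _ = tt
  adjacent⇒chain (x ∷ xs) r =
    r Fin.zero (Fin.suc Fin.zero) refl ,
    adjacent⇒chain xs (λ i j i~j → r (Fin.suc i) (Fin.suc j) (cong suc i~j))

  chain⇒lookup : ∀ {P : A → Set p} → (∀ {x y} → R x y → P y) →
    ∀ {a} {xs : Vec A n} → Chain R a xs → (i : Fin n) → P (lookup xs i)
  chain⇒lookup target {xs = x ∷ xs} (r , _) Fin.zero    = target r
  chain⇒lookup target {xs = x ∷ xs} (_ , c) (Fin.suc i) = chain⇒lookup target c i

nonincreasing⇒chain : ∀ {c} {cs : Vec ℤ n} → Nonincreasing (c ∷ cs) → Chain _≥_ c cs
nonincreasing⇒chain {cs = cs} = adjacent⇒chain cs

chain⇒nonincreasing : ∀ {c} {cs : Vec ℤ n} → Chain _≥_ c cs → Nonincreasing (c ∷ cs)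
chain⇒nonincreasing = chain⇒adjacent

LeStep : ℤ × ℤ → ℤ × ℤ → Set
LeStep (d , c) (d′ , c′) = d′ ≤ c′ × (c′ < c → d′ < d)

_≼_ : Vec ℤ (suc n) → Vec ℤ (suc n) → Set
(d ∷ ds) ≼ (c ∷ cs) = d ≤ c × Chain LeStep (d , c) (zip ds cs)

≤ₘ⇒≼ : (D C : 𝒫 (suc n)) → D ≤ₘ C → proj₁ D ≼ proj₁ C
≤ₘ⇒≼ (d ∷ ds , _) (c ∷ cs , _) (≤-pointwise , descent) =
  ≤-pointwise Fin.zero , adjacent⇒chain (zip ds cs) step
  where
  step : ∀ i j → Adjacent i j →
         LeStep (lookup (zip (d ∷ ds) (c ∷ cs)) i) (lookup (zip (d ∷ ds) (c ∷ cs)) j)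
  step i j i~j rewrite lookup-zip i (d ∷ ds) (c ∷ cs) | lookup-zip j (d ∷ ds) (c ∷ cs) =
    ≤-pointwise j , descent i j i~j

≼⇒≤ₘ : (D C : 𝒫 (suc n)) → proj₁ D ≼ proj₁ C → D ≤ₘ C
≼⇒≤ₘ (d ∷ ds , _) (c ∷ cs , _) (d≤c , chain) = ≤-pointwise , descent
  where
  ≤-pointwise : ∀ i → lookup (d ∷ ds) i ≤ lookup (c ∷ cs) i
  ≤-pointwise Fin.zero = d≤c
  ≤-pointwise (Fin.suc i) with chain⇒lookup {P = λ (d′ , c′) → d′ ≤ c′} proj₁ chain i
  ... | r rewrite lookup-zip i ds cs = r
  descent : ∀ i j → Adjacent i j →
            lookup (c ∷ cs) j < lookup (c ∷ cs) i → lookup (d ∷ ds) j < lookup (d ∷ ds) i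
  descent i j i~j with chain⇒adjacent chain i j i~j
  ... | r rewrite lookup-zip i (d ∷ ds) (c ∷ cs) | lookup-zip j (d ∷ ds) (c ∷ cs) = proj₂ r

≤ₘ-isPartialOrder : ∀ {m} → IsPartialOrder (_≈ₘ_ {m}) _≤ₘ_
≤ₘ-isPartialOrder = record
  { isPreorder = record
    { isEquivalence = record { refl = refl ; sym = sym ; trans = trans }
    ; reflexive     = λ { refl → (λ _ → ≤-refl) , (λ _ _ _ r → r) }
    ; trans         = λ (≤₁ , desc₁) (≤₂ , desc₂) →
        (λ i → ≤-trans (≤₁ i) (≤₂ i)) , (λ i j i~j r → desc₁ i j i~j (desc₂ i j i~j r))
    }
  ; antisym = λ (≤₁ , _) (≤₂ , _) → Pointwise-≡⇒≡ (ext (λ i → ≤-antisym (≤₁ i) (≤₂ i)))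
  }

⊔-lub-< : x < e → y < e → x ⊔ y < e
⊔-lub-< x<e y<e = i≤pred[j]⇒i<j (⊔-lub (i<j⇒i≤pred[j] x<e) (i<j⇒i≤pred[j] y<e))

-- The letter of the join at the position of x, y; c, d and e are the previous letters of C, D
-- and of the join.
joinStep : ℤ → ℤ → ℤ → ℤ → ℤ → ℤ
joinStep e c d x y with x <? c | y <? d
... | yes _ | yes _ = x ⊔ y
... | _     | _     = e

joinFrom : ℤ → ℤ → ℤ → Vec ℤ n → Vec ℤ n → Vec ℤ n
joinFrom e c d []       []       = []
joinFrom e c d (x ∷ xs) (y ∷ ys) = joinStep e c d x y ∷ joinFrom (joinStep e c d x y) x y xs ys

join : Vec ℤ (suc n) → Vec ℤ (suc n) → Vec ℤ (suc n)
join (c ∷ cs) (d ∷ ds) = (c ⊔ d) ∷ joinFrom (c ⊔ d) c d cs ds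

joinStep-bounds : x ≤ c → y ≤ d → c ≤ e → d ≤ e →
  joinStep e c d x y ≤ e × x ≤ joinStep e c d x y × y ≤ joinStep e c d x y
joinStep-bounds {x = x} {c = c} {y = y} {d = d} x≤c y≤d c≤e d≤e with x <? c | y <? d
... | yes _ | yes _ = ⊔-lub (≤-trans x≤c c≤e) (≤-trans y≤d d≤e) , i≤i⊔j x y , i≤j⊔i x y
... | yes _ | no _  = ≤-refl , ≤-trans x≤c c≤e , ≤-trans y≤d d≤e
... | no _  | _     = ≤-refl , ≤-trans x≤c c≤e , ≤-trans y≤d d≤e

joinStep<⇒descents : joinStep e c d x y < e → x < c × y < d
joinStep<⇒descents {c = c} {d = d} {x = x} {y = y} j<e with x <? c | y <? d
... | yes x<c | yes y<d = x<c , y<d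
... | yes _   | no _    = ⊥-elim (<-irrefl refl j<e)
... | no _    | _       = ⊥-elim (<-irrefl refl j<e)

joinStep-least : c ≤ e → d ≤ e → e ≤ f → f′ ≤ f → x ≤ f′ → y ≤ f′ →
  (f′ < f → x < c) → (f′ < f → y < d) →
  joinStep e c d x y ≤ f′ × (f′ < f → joinStep e c d x y < e)
joinStep-least {c = c} {d = d} {x = x} {y = y}
  c≤e d≤e e≤f f′≤f x≤f′ y≤f′ descˣ descʸ with x <? c | y <? d
... | yes x<c | yes y<d = ⊔-lub x≤f′ y≤f′ , λ _ → ⊔-lub-< (<-≤-trans x<c c≤e) (<-≤-trans y<d d≤e)
... | yes _   | no y≮d  =
  let f′≮f = λ f′<f → y≮d (descʸ f′<f) in ≤-trans e≤f (≮⇒≥ f′≮f) , λ f′<f → ⊥-elim (f′≮f f′<f)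
... | no x≮c  | _       =
  let f′≮f = λ f′<f → x≮c (descˣ f′<f) in ≤-trans e≤f (≮⇒≥ f′≮f) , λ f′<f → ⊥-elim (f′≮f f′<f)

joinFrom-nonincreasing : c ≤ e → d ≤ e → Chain _≥_ c xs → Chain _≥_ d ys →
  Chain _≥_ e (joinFrom e c d xs ys)
joinFrom-nonincreasing {xs = []}     {ys = []}     _   _   _          _          = tt
joinFrom-nonincreasing {xs = x ∷ xs} {ys = y ∷ ys} c≤e d≤e (x≤c , C↓) (y≤d , D↓) =
  let (j≤e , x≤j , y≤j) = joinStep-bounds x≤c y≤d c≤e d≤e
  in j≤e , joinFrom-nonincreasing x≤j y≤j C↓ D↓

joinFrom-upper : c ≤ e → d ≤ e → Chain _≥_ c xs → Chain _≥_ d ys →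
  Chain LeStep (c , e) (zip xs (joinFrom e c d xs ys)) ×
  Chain LeStep (d , e) (zip ys (joinFrom e c d xs ys))
joinFrom-upper {xs = []}     {ys = []}     _   _   _          _          = tt , tt
joinFrom-upper {c = c} {d = d} {xs = x ∷ xs} {ys = y ∷ ys} c≤e d≤e (x≤c , C↓) (y≤d , D↓) =
  let (_ , x≤j , y≤j)     = joinStep-bounds x≤c y≤d c≤e d≤e
      (upperˡ , upperʳ) = joinFrom-upper x≤j y≤j C↓ D↓
      descents          = joinStep<⇒descents {c = c} {d = d} {x = x} {y = y}
  in ((x≤j , λ j<e → proj₁ (descents j<e)) , upperˡ) ,
     ((y≤j , λ j<e → proj₂ (descents j<e)) , upperʳ)

joinFrom-least : c ≤ e → d ≤ e → e ≤ f → Chain _≥_ c xs → Chain _≥_ d ys → Chain _≥_ f fs →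
  Chain LeStep (c , f) (zip xs fs) → Chain LeStep (d , f) (zip ys fs) →
  Chain LeStep (e , f) (zip (joinFrom e c d xs ys) fs)
joinFrom-least {xs = []} {ys = []} {fs = []} _ _ _ _ _ _ _ _ = tt
joinFrom-least {xs = x ∷ xs} {ys = y ∷ ys} {fs = f′ ∷ fs} c≤e d≤e e≤f
  (x≤c , C↓) (y≤d , D↓) (f′≤f , F↓) ((x≤f′ , descˣ) , C≤F) ((y≤f′ , descʸ) , D≤F) =
  let (_ , x≤j , y≤j)  = joinStep-bounds x≤c y≤d c≤e d≤e
      (j≤f′ , descʲ) = joinStep-least c≤e d≤e e≤f f′≤f x≤f′ y≤f′ descˣ descʸ
  in (j≤f′ , descʲ) , joinFrom-least x≤j y≤j j≤f′ C↓ D↓ F↓ C≤F D≤F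

join-nonincreasing : ∀ {c d} {cs ds : Vec ℤ n} → Chain _≥_ c cs → Chain _≥_ d ds →
  Nonincreasing (join (c ∷ cs) (d ∷ ds))
join-nonincreasing {c = c} {d} C↓ D↓ =
  chain⇒nonincreasing (joinFrom-nonincreasing (i≤i⊔j c d) (i≤j⊔i c d) C↓ D↓)

join-upper : ∀ {c d} {cs ds : Vec ℤ n} → Chain _≥_ c cs → Chain _≥_ d ds →
  (c ∷ cs) ≼ join (c ∷ cs) (d ∷ ds) × (d ∷ ds) ≼ join (c ∷ cs) (d ∷ ds)
join-upper {c = c} {d} C↓ D↓ =
  let (upperˡ , upperʳ) = joinFrom-upper (i≤i⊔j c d) (i≤j⊔i c d) C↓ D↓
  in (i≤i⊔j c d , upperˡ) , (i≤j⊔i c d , upperʳ)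

join-least : ∀ {c d f} {cs ds fs : Vec ℤ n} → Chain _≥_ c cs → Chain _≥_ d ds → Chain _≥_ f fs →
  (c ∷ cs) ≼ (f ∷ fs) → (d ∷ ds) ≼ (f ∷ fs) → join (c ∷ cs) (d ∷ ds) ≼ (f ∷ fs)
join-least {c = c} {d} C↓ D↓ F↓ (c≤f , C≼F) (d≤f , D≼F) =
  ⊔-lub c≤f d≤f , joinFrom-least (i≤i⊔j c d) (i≤j⊔i c d) (⊔-lub c≤f d≤f) C↓ D↓ F↓ C≼F D≼F

⊓-pred< : x ⊓ y ⊓ pred e < e
⊓-pred< {x} {y} {e} = i≤pred[j]⇒i<j (i⊓j≤j (x ⊓ y) (pred e))

⊓-pred-bounds : x ⊓ y ⊓ pred e ≤ e × x ⊓ y ⊓ pred e ≤ x × x ⊓ y ⊓ pred e ≤ y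
⊓-pred-bounds {x} {y} {e} =
  <⇒≤ ⊓-pred< ,
  ≤-trans (i⊓j≤i (x ⊓ y) (pred e)) (i⊓j≤i x y) ,
  ≤-trans (i⊓j≤i (x ⊓ y) (pred e)) (i⊓j≤j x y)

⊓-pred-glb : f′ ≤ x → f′ ≤ y → f′ < e → f′ ≤ x ⊓ y ⊓ pred e
⊓-pred-glb f′≤x f′≤y f′<e = ⊓-glb (⊓-glb f′≤x f′≤y) (i<j⇒i≤pred[j] f′<e)

-- The letter of the meet at the position of x, y; c, d and e are the previous letters of C, D
-- and of the meet.
meetStep : ℤ → ℤ → ℤ → ℤ → ℤ → ℤ
meetStep e c d x y with x <? c | y <? d
... | no _ | no _ = e
... | _    | _    = x ⊓ y ⊓ pred e

meetFrom : ℤ → ℤ → ℤ → Vec ℤ n → Vec ℤ n → Vec ℤ n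
meetFrom e c d []       []       = []
meetFrom e c d (x ∷ xs) (y ∷ ys) = meetStep e c d x y ∷ meetFrom (meetStep e c d x y) x y xs ys

meet : Vec ℤ (suc n) → Vec ℤ (suc n) → Vec ℤ (suc n)
meet (c ∷ cs) (d ∷ ds) = (c ⊓ d) ∷ meetFrom (c ⊓ d) c d cs ds

meetStep-bounds : e ≤ c → e ≤ d →
  meetStep e c d x y ≤ e × meetStep e c d x y ≤ x × meetStep e c d x y ≤ y
meetStep-bounds {c = c} {d = d} {x = x} {y = y} e≤c e≤d with x <? c | y <? d
... | no x≮c | no y≮d = ≤-refl , ≤-trans e≤c (≮⇒≥ x≮c) , ≤-trans e≤d (≮⇒≥ y≮d)
... | yes _  | _      = ⊓-pred-bounds
... | no _   | yes _  = ⊓-pred-bounds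

meetStep-descends : ∀ {e c d x y} →
  (x < c → meetStep e c d x y < e) × (y < d → meetStep e c d x y < e)
meetStep-descends {e} {c} {d} {x} {y} with x <? c | y <? d
... | no x≮c | no y≮d = (λ x<c → ⊥-elim (x≮c x<c)) , (λ y<d → ⊥-elim (y≮d y<d))
... | yes _  | _      = (λ _ → ⊓-pred<) , (λ _ → ⊓-pred<)
... | no _   | yes _  = (λ _ → ⊓-pred<) , (λ _ → ⊓-pred<)

meetStep-greatest : f ≤ e → f′ ≤ f → f′ ≤ x → f′ ≤ y → (x < c → f′ < f) → (y < d → f′ < f) →
  f′ ≤ meetStep e c d x y × (meetStep e c d x y < e → f′ < f)
meetStep-greatest {x = x} {y = y} {c = c} {d = d} f≤e f′≤f f′≤x f′≤y descˣ descʸ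
  with x <? c | y <? d
... | no _    | no _    = ≤-trans f′≤f f≤e , λ e<e → ⊥-elim (<-irrefl refl e<e)
... | yes x<c | _       = ⊓-pred-glb f′≤x f′≤y (<-≤-trans (descˣ x<c) f≤e) , λ _ → descˣ x<c
... | no _    | yes y<d = ⊓-pred-glb f′≤x f′≤y (<-≤-trans (descʸ y<d) f≤e) , λ _ → descʸ y<d

meetFrom-nonincreasing : e ≤ c → e ≤ d → Chain _≥_ e (meetFrom e c d xs ys)
meetFrom-nonincreasing {xs = []}     {ys = []}     _   _   = tt
meetFrom-nonincreasing {xs = x ∷ xs} {ys = y ∷ ys} e≤c e≤d =
  let (m≤e , m≤x , m≤y) = meetStep-bounds e≤c e≤d
  in m≤e , meetFrom-nonincreasing m≤x m≤y

meetFrom-lower : e ≤ c → e ≤ d →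
  Chain LeStep (e , c) (zip (meetFrom e c d xs ys) xs) ×
  Chain LeStep (e , d) (zip (meetFrom e c d xs ys) ys)
meetFrom-lower {xs = []}     {ys = []}     _   _   = tt , tt
meetFrom-lower {e = e} {c = c} {d = d} {xs = x ∷ xs} {ys = y ∷ ys} e≤c e≤d =
  let (_ , m≤x , m≤y)     = meetStep-bounds e≤c e≤d
      (descˣ , descʸ)     = meetStep-descends {e} {c} {d} {x} {y}
      (lowerˡ , lowerʳ) = meetFrom-lower m≤x m≤y
  in ((m≤x , descˣ) , lowerˡ) , ((m≤y , descʸ) , lowerʳ)

meetFrom-greatest : f ≤ e → Chain _≥_ f fs →
  Chain LeStep (f , c) (zip fs xs) → Chain LeStep (f , d) (zip fs ys) →
  Chain LeStep (f , e) (zip fs (meetFrom e c d xs ys))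
meetFrom-greatest {fs = []} {xs = []} {ys = []} _ _ _ _ = tt
meetFrom-greatest {fs = f′ ∷ fs} {xs = x ∷ xs} {ys = y ∷ ys} f≤e
  (f′≤f , F↓) ((f′≤x , descˣ) , F≤C) ((f′≤y , descʸ) , F≤D) =
  let (f′≤m , descᵐ) = meetStep-greatest f≤e f′≤f f′≤x f′≤y descˣ descʸ
  in (f′≤m , descᵐ) , meetFrom-greatest f′≤m F↓ F≤C F≤D

meet-nonincreasing : ∀ {c d} {cs ds : Vec ℤ n} → Nonincreasing (meet (c ∷ cs) (d ∷ ds))
meet-nonincreasing {c = c} {d} =
  chain⇒nonincreasing (meetFrom-nonincreasing (i⊓j≤i c d) (i⊓j≤j c d))

meet-lower : ∀ {c d} {cs ds : Vec ℤ n} →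
  meet (c ∷ cs) (d ∷ ds) ≼ (c ∷ cs) × meet (c ∷ cs) (d ∷ ds) ≼ (d ∷ ds)
meet-lower {c = c} {d} =
  let (lowerˡ , lowerʳ) = meetFrom-lower (i⊓j≤i c d) (i⊓j≤j c d)
  in (i⊓j≤i c d , lowerˡ) , (i⊓j≤j c d , lowerʳ)

meet-greatest : ∀ {c d f} {cs ds fs : Vec ℤ n} → Chain _≥_ f fs →
  (f ∷ fs) ≼ (c ∷ cs) → (f ∷ fs) ≼ (d ∷ ds) → (f ∷ fs) ≼ meet (c ∷ cs) (d ∷ ds)
meet-greatest F↓ (f≤c , F≼C) (f≤d , F≼D) =
  ⊓-glb f≤c f≤d , meetFrom-greatest (⊓-glb f≤c f≤d) F↓ F≼C F≼D

_∨_ : Op₂ (𝒫 (suc n))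
(c ∷ cs , C↓) ∨ (d ∷ ds , D↓) =
  join (c ∷ cs) (d ∷ ds) , join-nonincreasing (nonincreasing⇒chain C↓) (nonincreasing⇒chain D↓)

_∧_ : Op₂ (𝒫 (suc n))
(c ∷ cs , _) ∧ (d ∷ ds , _) = meet (c ∷ cs) (d ∷ ds) , meet-nonincreasing

∨-supremum : Supremum (_≤ₘ_ {suc n}) _∨_
∨-supremum C@(c ∷ cs , C↓) D@(d ∷ ds , D↓) =
  let (C≼C∨D , D≼C∨D) = join-upper (nonincreasing⇒chain C↓) (nonincreasing⇒chain D↓)
  in ≼⇒≤ₘ C (C ∨ D) C≼C∨D , ≼⇒≤ₘ D (C ∨ D) D≼C∨D ,
     λ { E@(f ∷ fs , E↓) C≤E D≤E →
           ≼⇒≤ₘ (C ∨ D) E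
             (join-least (nonincreasing⇒chain C↓) (nonincreasing⇒chain D↓) (nonincreasing⇒chain E↓)
                         (≤ₘ⇒≼ C E C≤E) (≤ₘ⇒≼ D E D≤E)) }

∧-infimum : Infimum (_≤ₘ_ {suc n}) _∧_
∧-infimum C@(c ∷ cs , _) D@(d ∷ ds , _) =
  ≼⇒≤ₘ (C ∧ D) C (proj₁ meet-lower) , ≼⇒≤ₘ (C ∧ D) D (proj₂ meet-lower) ,
  λ { E@(f ∷ fs , E↓) E≤C E≤D →
        ≼⇒≤ₘ E (C ∧ D) (meet-greatest (nonincreasing⇒chain E↓) (≤ₘ⇒≼ E C E≤C) (≤ₘ⇒≼ E D E≤D)) }

proposition5p5 : (m : ℕ) → m ℕ.≥ 1 →
    Σ (Op₂ (𝒫 m)) λ _∨_ → Σ (Op₂ (𝒫 m)) λ _∧_ →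
      IsLattice (_≈ₘ_ {m}) (_≤ₘ_ {m}) _∨_ _∧_
proposition5p5 zero    ()
proposition5p5 (suc n) _  = _∨_ , _∧_ , record
  { isPartialOrder = ≤ₘ-isPartialOrder
  ; supremum       = ∨-supremum
  ; infimum        = ∧-infimum
  }
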